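{- Define, for $n\in\mathbb N$, $$z(n) := 3 + \big(3\cdot n!\big) \bmod (n+1), \qquad t(n) := 2 + \big(2\cdot n!\big) \bmod (n+1).$$ Define $$m_1(n) := z(2^{n+1}-2),\quad m_2(n) := z(2^{t(n)}-2),\quad f_1(n) := z(2^{n+2}),\quad f_2(n) := z(2^{2^n}).$$ Then: (i) For every $n\in\mathbb N$, $m_1(n)$ and $m_2(n)$ are Mersenne primes. Every Mersenne prime equals $m_1(n)$ for some $n\in\mathbb N$, and every Mersenne prime equals $m_2(n)$ for some $n\in\mathbb N$. (ii) For every $n\in\mathbb N$, $f_1(n)$ and $f_2(n)$ are Fermat primes. Every Fermat prime equals $f_1(n)$ for some $n\in\mathbb N$, and every Fermat prime equals $f_2(n)$ for some $n\in\mathbb N$.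
   Context: $\mathbb N=\{0,1,2,\dots\}$. For natural numbers $a$ and $b\ge 1$, $a \bmod b$ denotes the remainder of $a$ upon division by $b$; in particular $a \bmod 1 = 0$. A Mersenne prime is a prime number of the form $2^n-1$ with $n\in\mathbb N$. A Fermat prime is a prime number of the form $2^{2^k}+1$ with $k\ge 0$; under this convention $2$ is not a Fermat prime. -}

module Defs where

open import Data.Nat using (ℕ; suc; _+_; _*_; _∸_; _^_; _!)
open import Data.Nat.DivMod using (_%_)

open import Data.Nat.Primality using (Prime)
open import Data.Product using (_×_; ∃-syntax)
open import Relation.Binary.PropositionalEquality using (_≡_)

z : ℕ → ℕ
z n = 3 + (3 * (n !)) % suc n

t : ℕ → ℕ
t n = 2 + (2 * (n !)) % suc n

m₁ m₂ f₁ f₂ : ℕ → ℕ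
m₁ n = z (2 ^ (n + 1) ∸ 2)
m₂ n = z (2 ^ t n ∸ 2)
f₁ n = z (2 ^ (n + 2))
f₂ n = z (2 ^ (2 ^ n))

MersennePrime : ℕ → Set
MersennePrime p = Prime p × ∃[ n ] p ≡ 2 ^ n ∸ 1

FermatPrime : ℕ → Set
FermatPrime p = Prime p × ∃[ k ] p ≡ 2 ^ (2 ^ k) + 1

-- By Wilson's theorem, if p = n + 1 is prime then c · n! ≡ -c (mod p), so
-- c + (c · n!) mod p = p whenever 1 ≤ c ≤ p; if n + 1 is composite and not 4,
-- then n + 1 divides n!, and the same expression equals c. Thus z n = n + 1
-- for odd primes n + 1, z n = 3 for composite n + 1 ≠ 4, and t k = k + 1
-- whenever k + 1 is prime. Wilson's theorem itself comes from pairing each of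
-- 2, …, p - 2 with its inverse modulo p, which is distinct from it.
--
-- Mersenne numbers 2^k - 1 (k ≥ 2) and the numbers 2^m + 1 (m ≥ 1) are odd,
-- so z(2^k - 2) and z(2^m) are either these numbers, when they are prime, or
-- 3 = 2^2 - 1 = 2^(2^0) + 1. A prime 2^m + 1 is a Fermat prime because a
-- prime a^m + 1 (a ≥ 2) forces m to be a power of 2: an odd factor q > 1 of
-- m gives the divisor a^(m/q) + 1. Conversely every Mersenne or Fermat prime
-- p is z(p - 1), and p - 1 = 2^k - 2 has the required shape for m₂ because
-- the exponent k of a Mersenne prime is itself prime, so t(k - 1) = k.

module Submission where

open import Defs
open import Data.Nat using (ℕ)
open import Data.Product using (_×_; ∃-syntax)
open import Relation.Binary.PropositionalEquality using (_≡_)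

open import Data.Nat.Base
open import Data.Nat.Properties
open import Data.Nat.DivMod
  using ( _%_; _/_; m≡m%n+[m/n]*n; m%n%n≡m%n; m%n<n; %-distribˡ-+; %-distribˡ-*; %-pred-≡0
        ; m*n%n≡0; n%n≡0; [m+n]%n≡m%n; [m+kn]%n≡m%n; m<n⇒m%n≡m; m≤n⇒m%n≡m )
open import Data.Nat.Divisibility
open import Data.Nat.Primality
  using ( Prime; Composite; composite; prime?; euclidsLemma; ¬prime[0]; ¬prime[1]
        ; ¬prime⇒composite; ¬composite⇒prime; prime⇒¬composite )
open import Data.Nat.Coprimality using (prime⇒coprime; coprime-Bézout)
open import Data.Nat.GCD using (module Bézout)
open import Data.Nat.ListAction using (product)
open import Data.List.Base using (List; []; _∷_; length; filter; applyDownFrom)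
open import Data.List.Properties using (length-filter; filter-accept; filter-reject; filter-all)
open import Data.List.Membership.Propositional using (_∈_)
open import Data.List.Membership.Propositional.Properties
  using (∈-filter⁺; ∈-filter⁻; ∈-applyDownFrom⁺; ∈-applyDownFrom⁻)
open import Data.List.Relation.Unary.Any using (here; there)
open import Data.List.Relation.Unary.All as All using (All)
open import Data.List.Relation.Unary.Unique.Propositional using (Unique; []; _∷_)
open import Data.List.Relation.Unary.Unique.Propositional.Properties as Unique using ()
open import Data.Product using (_,_; proj₁; proj₂)
open import Data.Sum using (_⊎_; inj₁; inj₂)
open import Relation.Binary.Definitions using (tri<; tri≈; tri>)
open import Relation.Nullary using (¬_; ¬?; Dec; yes; no; contradiction)
open import Relation.Nullary.Decidable using (toWitness)
open import Data.Unit using (tt)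
open import Function.Base using (_∘_; _$_)
open import Relation.Binary.PropositionalEquality
  using (refl; sym; trans; cong; cong₂; subst; _≢_; ≢-sym; module ≡-Reasoning)
open import Data.Nat.Tactic.RingSolver using (solve-∀)
open import Data.Nat.Induction using (<-rec)
open import Level using (0ℓ)
open import Relation.Binary.Bundles using (Setoid)
import Relation.Binary.Reasoning.Setoid as SetoidReasoning

-- Congruence modulo d

-- A record rather than m % d ≡ n % d, so that m and n can be inferred from proofs.
infix 4 _≡_mod_
record _≡_mod_ (m n d : ℕ) .{{_ : NonZero d}} : Set where
  constructor congruent
  field
    residues-≡ : m % d ≡ n % d

open _≡_mod_ using (residues-≡)

module _ {d : ℕ} .{{_ : NonZero d}} where

  mod-refl : ∀ {m} → m ≡ m mod d
  mod-refl = congruent refl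

  mod-sym : ∀ {m n} → m ≡ n mod d → n ≡ m mod d
  mod-sym (congruent e) = congruent (sym e)

  mod-trans : ∀ {m n o} → m ≡ n mod d → n ≡ o mod d → m ≡ o mod d
  mod-trans (congruent e) (congruent f) = congruent (trans e f)

  mod-setoid : Setoid 0ℓ 0ℓ
  mod-setoid = record
    { Carrier       = ℕ
    ; _≈_           = λ m n → m ≡ n mod d
    ; isEquivalence = record { refl = mod-refl ; sym = mod-sym ; trans = mod-trans }
    }

  ≡⇒≡-mod : ∀ {m n} → m ≡ n → m ≡ n mod d
  ≡⇒≡-mod refl = mod-refl

  %-mod : ∀ m → m % d ≡ m mod d
  %-mod m = congruent (m%n%n≡m%n m d)

  +-cong-mod : ∀ {a b c e} → a ≡ b mod d → c ≡ e mod d → a + c ≡ b + e mod d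
  +-cong-mod {a} {b} {c} {e} (congruent a≡b) (congruent c≡e) = congruent (begin
    (a + c) % d           ≡⟨ %-distribˡ-+ a c d ⟩
    (a % d + c % d) % d   ≡⟨ cong₂ (λ x y → (x + y) % d) a≡b c≡e ⟩
    (b % d + e % d) % d   ≡⟨ %-distribˡ-+ b e d ⟨
    (b + e) % d           ∎)
    where open ≡-Reasoning

  *-cong-mod : ∀ {a b c e} → a ≡ b mod d → c ≡ e mod d → a * c ≡ b * e mod d
  *-cong-mod {a} {b} {c} {e} (congruent a≡b) (congruent c≡e) = congruent (begin
    (a * c) % d           ≡⟨ %-distribˡ-* a c d ⟩
    (a % d * (c % d)) % d ≡⟨ cong₂ (λ x y → (x * y) % d) a≡b c≡e ⟩
    (b % d * (e % d)) % d ≡⟨ %-distribˡ-* b e d ⟨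
    (b * e) % d           ∎)
    where open ≡-Reasoning

  *-congˡ-mod : ∀ a {c e} → c ≡ e mod d → a * c ≡ a * e mod d
  *-congˡ-mod a = *-cong-mod (mod-refl {a})

  *-congʳ-mod : ∀ c {a b} → a ≡ b mod d → a * c ≡ b * c mod d
  *-congʳ-mod c a≡b = *-cong-mod a≡b (mod-refl {c})

  ^-cong-mod : ∀ {a b} n → a ≡ b mod d → a ^ n ≡ b ^ n mod d
  ^-cong-mod zero    _   = mod-refl
  ^-cong-mod (suc n) a≡b = *-cong-mod a≡b (^-cong-mod n a≡b)

  ≡-mod⇒∣∸ : ∀ {m n} → m ≡ n mod d → d ∣ m ∸ n
  ≡-mod⇒∣∸ {m} {n} (congruent m≡n) = divides (m / d ∸ n / d) (begin
    m ∸ n                                     ≡⟨ cong₂ _∸_ (m≡m%n+[m/n]*n m d) (m≡m%n+[m/n]*n n d) ⟩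
    (m % d + m / d * d) ∸ (n % d + n / d * d) ≡⟨ cong (λ r → (m % d + m / d * d) ∸ (r + n / d * d)) m≡n ⟨
    (m % d + m / d * d) ∸ (m % d + n / d * d) ≡⟨ [m+n]∸[m+o]≡n∸o (m % d) _ _ ⟩
    m / d * d ∸ n / d * d                     ≡⟨ *-distribʳ-∸ d (m / d) (n / d) ⟨
    (m / d ∸ n / d) * d                       ∎)
    where open ≡-Reasoning

  ≡-mod⇒≡ : ∀ {m n} → m < d → n < d → m ≡ n mod d → m ≡ n
  ≡-mod⇒≡ {m} {n} m<d n<d (congruent m≡n) = begin
    m      ≡⟨ m<n⇒m%n≡m m<d ⟨
    m % d  ≡⟨ m≡n ⟩
    n % d  ≡⟨ m<n⇒m%n≡m n<d ⟩
    n      ∎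
    where open ≡-Reasoning

  inverse-sym : ∀ x y → x * y ≡ 1 mod d → y * x ≡ 1 mod d
  inverse-sym x y = mod-trans (≡⇒≡-mod (*-comm y x))

  inverse-unique : ∀ x {y y′} → x * y ≡ 1 mod d → x * y′ ≡ 1 mod d → y ≡ y′ mod d
  inverse-unique x {y} {y′} xy≡1 xy′≡1 = begin
    y            ≡⟨ *-identityʳ y ⟨
    y * 1        ≈⟨ *-congˡ-mod y xy′≡1 ⟨
    y * (x * y′) ≡⟨ reassociate y x y′ ⟩
    x * y * y′   ≈⟨ *-congʳ-mod y′ xy≡1 ⟩
    1 * y′       ≡⟨ *-identityˡ y′ ⟩
    y′           ∎
    where
    open SetoidReasoning mod-setoid
    reassociate : ∀ a b c → a * (b * c) ≡ b * a * c
    reassociate = solve-∀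

n*n≡1-mod-suc-n : ∀ n → n * n ≡ 1 mod suc n
n*n≡1-mod-suc-n zero    = congruent refl
n*n≡1-mod-suc-n (suc k) = congruent (trans (cong (_% suc (suc k)) (square k)) ([m+kn]%n≡m%n 1 k (suc (suc k))))
  where
  square : ∀ k → suc k * suc k ≡ 1 + k * suc (suc k)
  square = solve-∀

_≢?_ : (x y : ℕ) → Dec (x ≢ y)
x ≢? y = ¬? (x ≟ y)

_without_ : List ℕ → ℕ → List ℕ
xs without y = filter (_≢? y) xs

module _ {y : ℕ} {xs : List ℕ} where

  ∈-without⁺ : ∀ {x} → x ∈ xs → x ≢ y → x ∈ xs without y
  ∈-without⁺ = ∈-filter⁺ (_≢? y)

  ∈-without⁻ : ∀ {x} → x ∈ xs without y → x ∈ xs × x ≢ y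
  ∈-without⁻ = ∈-filter⁻ (_≢? y)

  length-without : length (xs without y) ≤ length xs
  length-without = length-filter (_≢? y) xs

  unique-without : Unique xs → Unique (xs without y)
  unique-without = Unique.filter⁺ (_≢? y)

product-without : ∀ {y xs} → Unique xs → y ∈ xs → product xs ≡ y * product (xs without y)
product-without {y} {x ∷ xs} (x∉xs ∷ _) (here refl) = begin
  x * product xs                   ≡⟨ cong (λ ys → x * product ys) (filter-all (_≢? x) (All.map ≢-sym x∉xs)) ⟨
  x * product (xs without x)       ≡⟨ cong (λ ys → x * product ys) (filter-reject (_≢? x) {xs = xs} (_$ refl)) ⟨
  x * product ((x ∷ xs) without x) ∎
  where open ≡-Reasoning
product-without {y} {x ∷ xs} (x∉xs ∷ unique) (there y∈xs) = begin
  x * product xs                   ≡⟨ cong (x *_) (product-without unique y∈xs) ⟩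
  x * (y * product (xs without y)) ≡⟨ x∙yz≈y∙xz x y _ ⟩
  y * (x * product (xs without y)) ≡⟨ cong (λ ys → y * product ys) (filter-accept (_≢? y) (All.lookup x∉xs y∈xs)) ⟨
  y * product ((x ∷ xs) without y) ∎
  where
  open ≡-Reasoning
  x∙yz≈y∙xz : ∀ a b c → a * (b * c) ≡ b * (a * c)
  x∙yz≈y∙xz = solve-∀

∈-tail : ∀ {u x} {xs : List ℕ} → u ∈ x ∷ xs → u ≢ x → u ∈ xs
∈-tail (here u≡x) u≢x = contradiction u≡x u≢x
∈-tail (there u∈xs) _ = u∈xs

module _ {d : ℕ} .{{_ : NonZero d}} where

  InverseClosed : List ℕ → Set
  InverseClosed xs = ∀ {x} → x ∈ xs → ∃[ y ] (y ∈ xs × x * y ≡ 1 mod d)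

  product-inverseClosed : ∀ n xs → length xs ≤ n → Unique xs →
                          (∀ {x} → x ∈ xs → x < d) →
                          (∀ {x} → x ∈ xs → ¬ (x * x ≡ 1 mod d)) →
                          InverseClosed xs →
                          product xs ≡ 1 mod d
  product-inverseClosed _ [] _ _ _ _ _ = mod-refl
  product-inverseClosed (suc n) (x ∷ xs) (s≤s |xs|≤n) (x∉xs ∷ unique) residue notSelfInverse closed
    with closed (here refl)
  ... | y , y∈x∷xs , xy≡1 = begin
      x * product xs         ≡⟨ cong (x *_) (product-without unique y∈xs) ⟩
      x * (y * product ys)   ≡⟨ *-assoc x y _ ⟨
      x * y * product ys     ≈⟨ *-cong-mod xy≡1 product-ys≡1 ⟩
      1                      ∎
    where
    open SetoidReasoning mod-setoid
    y∈xs : y ∈ xs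
    y∈xs = ∈-tail y∈x∷xs λ { refl → notSelfInverse (here refl) xy≡1 }
    ys : List ℕ
    ys = xs without y
    ∈ys⁻ : ∀ {u} → u ∈ ys → u ∈ xs × u ≢ y
    ∈ys⁻ = ∈-without⁻ {y} {xs}
    ys⊆ : ∀ {u} → u ∈ ys → u ∈ x ∷ xs
    ys⊆ u∈ys = there (proj₁ (∈ys⁻ u∈ys))
    -- Inverses of residues are unique, so the partner w of u is neither x
    -- (whose inverse is y ≢ u) nor y (whose inverse is x ∉ xs).
    ys-closed : InverseClosed ys
    ys-closed {u} u∈ys with closed (ys⊆ u∈ys)
    ... | w , w∈ , uw≡1 = w , ∈-without⁺ (∈-tail w∈ w≢x) w≢y , uw≡1
      where
      u≢y : u ≢ y
      u≢y = proj₂ (∈ys⁻ u∈ys)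
      w≢x : w ≢ x
      w≢x refl = u≢y (≡-mod⇒≡ (residue (ys⊆ u∈ys)) (residue (there y∈xs))
                               (inverse-unique x (inverse-sym u x uw≡1) xy≡1))
      w≢y : w ≢ y
      w≢y refl = All.lookup x∉xs (proj₁ (∈ys⁻ u∈ys))
                   (≡-mod⇒≡ (residue (here refl)) (residue (ys⊆ u∈ys))
                            (inverse-unique y (inverse-sym x y xy≡1) (inverse-sym u y uw≡1)))
    product-ys≡1 : product ys ≡ 1 mod d
    product-ys≡1 = product-inverseClosed n ys (≤-trans (length-without {y} {xs}) |xs|≤n) (unique-without unique)
                     (residue ∘ ys⊆) (notSelfInverse ∘ ys⊆) ys-closed

-- Wilson's theorem

∣∧<⇒≡0 : ∀ {d m} → d ∣ m → m < d → m ≡ 0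
∣∧<⇒≡0 {m = zero}  _   _   = refl
∣∧<⇒≡0 {m = suc m} d∣m m<d = contradiction d∣m (>⇒∤ m<d)

≢0∧≢1⇒>1 : ∀ {y} → y ≢ 0 → y ≢ 1 → 1 < y
≢0∧≢1⇒>1 {0}           y≢0 _   = contradiction refl y≢0
≢0∧≢1⇒>1 {1}           _   y≢1 = contradiction refl y≢1
≢0∧≢1⇒>1 {suc (suc _)} _   _   = s≤s (s≤s z≤n)

module Units {n : ℕ} (isPrime : Prime (suc n)) where

  inverse-exists : ∀ {x} → 0 < x → x < suc n → ∃[ y ] (y < suc n × x * y ≡ 1 mod suc n)
  inverse-exists {x} 0<x x<p =
    y % suc n , m%n<n y (suc n) , mod-trans (*-congˡ-mod x (%-mod y)) (proj₂ inverse)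
    where
    inverse : ∃[ y ] x * y ≡ 1 mod suc n
    inverse with coprime-Bézout (prime⇒coprime isPrime {{>-nonZero 0<x}} x<p)
    -- Here b x ≡ -1 ≡ n, and n is its own inverse.
    ... | Bézout.+- a b 1+bx≡ap = n * b , (begin
      x * (n * b) ≡⟨ x∙yz≈y∙zx x n b ⟩
      n * (b * x) ≈⟨ *-congˡ-mod n bx≡n ⟩
      n * n       ≈⟨ n*n≡1-mod-suc-n n ⟩
      1           ∎)
      where
      open SetoidReasoning mod-setoid
      x∙yz≈y∙zx : ∀ a b c → a * (b * c) ≡ b * (c * a)
      x∙yz≈y∙zx = solve-∀
      bx≡n : b * x ≡ n mod suc n
      bx≡n = congruent (trans (%-pred-≡0 (trans (cong (_% suc n) 1+bx≡ap) (m*n%n≡0 a (suc n))))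
                              (sym (m<n⇒m%n≡m (n<1+n n))))
    ... | Bézout.-+ a b 1+ap≡bx = b , (begin
      x * b         ≡⟨ trans (*-comm x b) (sym 1+ap≡bx) ⟩
      1 + a * suc n ≈⟨ congruent ([m+kn]%n≡m%n 1 a (suc n)) ⟩
      1             ∎)
      where open SetoidReasoning mod-setoid
    y : ℕ
    y = proj₁ inverse

  selfInverse⇒±1 : ∀ {x} → 0 < x → x < suc n → x * x ≡ 1 mod suc n → x ≡ 1 ⊎ x ≡ n
  selfInverse⇒±1 {suc y} _ x<p xx≡1
    with euclidsLemma y (suc (suc y)) isPrime (subst (suc n ∣_) (sym (*-suc y (suc y))) (≡-mod⇒∣∸ xx≡1))
  ... | inj₁ p∣y   = inj₁ (cong suc (∣∧<⇒≡0 p∣y (<-trans (n<1+n y) x<p)))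
  ... | inj₂ p∣2+y = inj₂ (suc-injective (≤-antisym x<p (∣⇒≤ p∣2+y)))

factorialFactors : ℕ → List ℕ
factorialFactors = applyDownFrom (2 +_)

product-factorialFactors : ∀ k → product (factorialFactors k) ≡ suc k !
product-factorialFactors zero    = refl
product-factorialFactors (suc k) = cong ((2 + k) *_) (product-factorialFactors k)

∈-factorialFactors⁻ : ∀ {k x} → x ∈ factorialFactors k → 2 ≤ x × x ≤ suc k
∈-factorialFactors⁻ x∈ with i , i<k , refl ← ∈-applyDownFrom⁻ (2 +_) x∈ = m≤m+n 2 i , s≤s i<k

∈-factorialFactors⁺ : ∀ {k x} → 2 ≤ x → x ≤ suc k → x ∈ factorialFactors k
∈-factorialFactors⁺ {x = suc (suc i)} (s≤s (s≤s z≤n)) (s≤s i<k) = ∈-applyDownFrom⁺ (2 +_) i<k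

unique-factorialFactors : ∀ k → Unique (factorialFactors k)
unique-factorialFactors k =
  Unique.applyDownFrom⁺₁ (2 +_) k λ j<i _ 2+i≡2+j → <⇒≢ j<i (sym (+-cancelˡ-≡ 2 _ _ 2+i≡2+j))

module _ {k : ℕ} (isPrime : Prime (3 + k)) where
  open Units isPrime

  product-factorialFactors≡1 : product (factorialFactors k) ≡ 1 mod 3 + k
  product-factorialFactors≡1 =
    product-inverseClosed _ (factorialFactors k) ≤-refl (unique-factorialFactors k) residue notSelfInverse closed
    where
    positive : ∀ {x} → x ∈ factorialFactors k → 0 < x
    positive x∈ = <-trans z<s (proj₁ (∈-factorialFactors⁻ x∈))
    residue : ∀ {x} → x ∈ factorialFactors k → x < 3 + k
    residue x∈ = s≤s (m≤n⇒m≤1+n (proj₂ (∈-factorialFactors⁻ x∈)))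
    notSelfInverse : ∀ {x} → x ∈ factorialFactors k → ¬ (x * x ≡ 1 mod 3 + k)
    notSelfInverse x∈ xx≡1 with ∈-factorialFactors⁻ x∈ | selfInverse⇒±1 (positive x∈) (residue x∈) xx≡1
    ... | 2≤x , _   | inj₁ refl = contradiction 2≤x λ { (s≤s ()) }
    ... | _ , x≤1+k | inj₂ refl = contradiction x≤1+k (<⇒≱ (n<1+n _))
    closed : InverseClosed (factorialFactors k)
    closed {x} x∈ with ∈-factorialFactors⁻ x∈ | inverse-exists (positive x∈) (residue x∈)
    ... | 2≤x , x≤1+k | y , y<p , xy≡1 = y , ∈-factorialFactors⁺ (≢0∧≢1⇒>1 y≢0 y≢1) y≤1+k , xy≡1
      where
      y≢0 : y ≢ 0
      y≢0 refl = 0≢1+n (residues-≡ (mod-trans (≡⇒≡-mod (sym (*-zeroʳ x))) xy≡1))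
      y≢1 : y ≢ 1
      y≢1 refl = <⇒≱ 2≤x (≤-reflexive (≡-mod⇒≡ (residue x∈) (s≤s (s≤s z≤n))
                   (mod-trans (≡⇒≡-mod (sym (*-identityʳ x))) xy≡1)))
      y≢2+k : y ≢ 2 + k
      y≢2+k refl = <⇒≱ (n<1+n _) (subst (_≤ suc k) x≡2+k x≤1+k)
        where
        x≡2+k : x ≡ 2 + k
        x≡2+k = ≡-mod⇒≡ (residue x∈) ≤-refl
                  (inverse-unique (2 + k) (inverse-sym x (2 + k) xy≡1) (n*n≡1-mod-suc-n (2 + k)))
      y≤1+k : y ≤ suc k
      y≤1+k = ≤-pred (≤∧≢⇒< (≤-pred y<p) y≢2+k)

wilson : ∀ {n} → Prime (suc n) → n ! ≡ n mod suc n
wilson {0}           isPrime = contradiction isPrime ¬prime[1]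
wilson {1}           _       = mod-refl
wilson {suc (suc k)} isPrime = begin
  (2 + k) * suc k !                      ≡⟨ cong ((2 + k) *_) (product-factorialFactors k) ⟨
  (2 + k) * product (factorialFactors k) ≈⟨ *-congˡ-mod (2 + k) (product-factorialFactors≡1 isPrime) ⟩
  (2 + k) * 1                            ≡⟨ *-identityʳ (2 + k) ⟩
  2 + k                                  ∎
  where open SetoidReasoning mod-setoid

0<m≤n⇒m∣n! : ∀ {m n} → 0 < m → m ≤ n → m ∣ n !
0<m≤n⇒m∣n! {suc m} _ m≤n = ∣-trans (m∣m*n (m !)) (m≤n⇒m!∣n! m≤n)

0<m<n≤o⇒m*n∣o! : ∀ {m n o} → 0 < m → m < n → n ≤ o → m * n ∣ o !
0<m<n≤o⇒m*n∣o! {m} {suc n} 0<m m<n n≤o = ∣-trans m*[1+n]∣[1+n]! (m≤n⇒m!∣n! n≤o)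
  where
  m*[1+n]∣[1+n]! : m * suc n ∣ suc n !
  m*[1+n]∣[1+n]! = subst (m * suc n ∣_) (*-comm (n !) (suc n)) (*-pres-∣ (0<m≤n⇒m∣n! 0<m (≤-pred m<n)) ∣-refl)

d*d≡1+n⇒d*d∣n! : ∀ {d n} → 2 < d → d * d ≡ suc n → d * d ∣ n !
d*d≡1+n⇒d*d∣n! {d} {n} 2<d d*d≡1+n =
  ∣-trans (*-monoʳ-∣ d (∣m∣n⇒∣m+n (∣-refl {d}) ∣-refl)) (0<m<n≤o⇒m*n∣o! 0<d (m<m+n d 0<d) 2d≤n)
  where
  open ≤-Reasoning
  0<d : 0 < d
  0<d = ≤-trans (s≤s z≤n) 2<d
  2d≤n : d + d ≤ n
  2d≤n = ≤-pred (begin-strict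
    d + d     <⟨ m<m+n (d + d) 0<d ⟩
    d + d + d ≡⟨ triple d ⟩
    3 * d     ≤⟨ *-monoˡ-≤ d 2<d ⟩
    d * d     ≡⟨ d*d≡1+n ⟩
    suc n     ∎)
    where
    triple : ∀ d → d + d + d ≡ 3 * d
    triple = solve-∀

¬prime⇒1+n∣n! : ∀ {n} → ¬ Prime (suc n) → suc n ≢ 4 → suc n ∣ n !
¬prime⇒1+n∣n! {0}     _      _   = ∣-refl
¬prime⇒1+n∣n! {suc n} ¬prime N≢4
  with composite {d} d<N d∣N@(divides q N≡qd) ← ¬prime⇒composite ¬prime
  with <-cmp q d
... | tri< q<d _ _  = subst (_∣ suc n !) (sym N≡qd) (0<m<n≤o⇒m*n∣o! 0<q q<d (≤-pred d<N))
  where 0<q = <-trans z<s (quotient>1 d∣N d<N)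
... | tri> _ _ d<q  = subst (_∣ suc n !) (trans (*-comm d q) (sym N≡qd))
                        (0<m<n≤o⇒m*n∣o! (<-trans z<s (nonTrivial⇒n>1 d)) d<q (≤-pred q<N))
  where q<N = quotient-< d∣N
... | tri≈ _ refl _ = subst (_∣ suc n !) (sym N≡qd) (d*d≡1+n⇒d*d∣n! 2<d (sym N≡qd))
  where
  2<d : 2 < d
  2<d = ≤∧≢⇒< (nonTrivial⇒n>1 d) λ { refl → N≢4 N≡qd }

-- z = wilsonTest 3 and t = wilsonTest 2 definitionally.
wilsonTest : ℕ → ℕ → ℕ
wilsonTest c n = c + (c * n !) % suc n

[1+c]*[c+e]%[1+c+e]≡e : ∀ c e → (suc c * (c + e)) % suc (c + e) ≡ e
[1+c]*[c+e]%[1+c+e]≡e c e = begin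
  (suc c * (c + e)) % suc (c + e)         ≡⟨ cong (_% suc (c + e)) (expand c e) ⟩
  (e + c * suc (c + e)) % suc (c + e)     ≡⟨ [m+kn]%n≡m%n e c (suc (c + e)) ⟩
  e % suc (c + e)                         ≡⟨ m≤n⇒m%n≡m (m≤n+m e c) ⟩
  e                                       ∎
  where
  open ≡-Reasoning
  expand : ∀ c e → suc c * (c + e) ≡ e + c * suc (c + e)
  expand = solve-∀

wilsonTest-prime : ∀ {c n} → Prime (suc n) → 0 < c → c ≤ suc n → wilsonTest c n ≡ suc n
wilsonTest-prime {suc c} isPrime _ (s≤s c≤n) with e , refl ← m≤n⇒∃[o]m+o≡n c≤n =
  cong (suc c +_) (trans (residues-≡ (*-congˡ-mod (suc c) (wilson isPrime))) ([1+c]*[c+e]%[1+c+e]≡e c e))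

wilsonTest-∣ : ∀ c {n} → suc n ∣ n ! → wilsonTest c n ≡ c
wilsonTest-∣ c {n} N∣n! = trans (cong (c +_) (n∣m⇒m%n≡0 (c * n !) (suc n) (∣n⇒∣m*n c N∣n!))) (+-identityʳ c)

z-prime : ∀ {n} → Prime (suc n) → n ≢ 1 → z n ≡ suc n
z-prime {n} isPrime n≢1 = wilsonTest-prime isPrime z<s (s≤s (≢0∧≢1⇒>1 n≢0 n≢1))
  where
  n≢0 : n ≢ 0
  n≢0 refl = ¬prime[1] isPrime

t-prime : ∀ {n} → Prime (suc n) → t n ≡ suc n
t-prime {n} isPrime = wilsonTest-prime isPrime z<s (s≤s (n≢0⇒n>0 n≢0))
  where
  n≢0 : n ≢ 0
  n≢0 refl = ¬prime[1] isPrime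

z-cases : ∀ n → n ≢ 1 → n ≢ 3 → (Prime (suc n) × z n ≡ suc n) ⊎ z n ≡ 3
z-cases n n≢1 n≢3 with prime? (suc n)
... | yes isPrime = inj₁ (isPrime , z-prime isPrime n≢1)
... | no  ¬prime  = inj₂ (wilsonTest-∣ 3 (¬prime⇒1+n∣n! ¬prime (n≢3 ∘ suc-injective)))

-- Exponents of Mersenne and Fermat primes

m∣[1+m]^q∸1 : ∀ m .{{_ : NonZero m}} q → m ∣ suc m ^ q ∸ 1
m∣[1+m]^q∸1 m q = subst (λ x → m ∣ suc m ^ q ∸ x) (^-zeroˡ q)
  (≡-mod⇒∣∸ (^-cong-mod q (congruent ([m+n]%n≡m%n 1 m))))

^∸1-composite : ∀ {a k} → 1 < a → Composite k → Composite (a ^ k ∸ 1)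
^∸1-composite {a} {k} 1<a (composite {d} d<k (divides q k≡qd)) =
  composite M<N M∣N
  where
  M : ℕ
  M = a ^ d ∸ 1
  2<a^d : 2 < a ^ d
  2<a^d = ≤-<-trans (≤-trans 1<a (≤-reflexive (sym (*-identityʳ a)))) (^-monoʳ-< a 1<a (nonTrivial⇒n>1 d))
  1≤a^d : 1 ≤ a ^ d
  1≤a^d = ≤-trans (s≤s z≤n) (<⇒≤ 2<a^d)
  1<M : 1 < M
  1<M = ∸-monoˡ-< 2<a^d (s≤s z≤n)
  instance
    M-nonTrivial : NonTrivial M
    M-nonTrivial = n>1⇒nonTrivial 1<M
  M<N : M < a ^ k ∸ 1
  M<N = ∸-monoˡ-< (^-monoʳ-< a 1<a d<k) 1≤a^d
  M∣N : M ∣ a ^ k ∸ 1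
  M∣N = subst (λ x → M ∣ x ∸ 1) a^d^q≡a^k
          (subst (λ x → M ∣ x ^ q ∸ 1) (m+[n∸m]≡n 1≤a^d)
            (m∣[1+m]^q∸1 M {{nonTrivial⇒nonZero M}} q))
    where
    a^d^q≡a^k : (a ^ d) ^ q ≡ a ^ k
    a^d^q≡a^k = trans (^-*-assoc a d q) (cong (a ^_) (trans (*-comm d q) (sym k≡qd)))

mersenne-exponent-prime : ∀ k → Prime (2 ^ k ∸ 1) → Prime k
mersenne-exponent-prime 0             isPrime = contradiction isPrime ¬prime[0]
mersenne-exponent-prime 1             isPrime = contradiction isPrime ¬prime[1]
mersenne-exponent-prime (suc (suc k)) isPrime =
  ¬composite⇒prime (prime⇒¬composite isPrime ∘ ^∸1-composite (s≤s (s≤s z≤n)))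

1+a∣a^[1+2r]+1 : ∀ a r → suc a ∣ a ^ suc (2 * r) + 1
1+a∣a^[1+2r]+1 a r = m%n≡0⇒n∣m _ (suc a) (residues-≡ (begin
  a ^ suc (2 * r) + 1  ≡⟨ cong (λ x → a * x + 1) (^-*-assoc a 2 r) ⟨
  a * (a ^ 2) ^ r + 1  ≈⟨ +-cong-mod (*-congˡ-mod a (^-cong-mod r a²≡1)) (mod-refl {m = 1}) ⟩
  a * 1 ^ r + 1        ≡⟨ cong (λ x → a * x + 1) (^-zeroˡ r) ⟩
  a * 1 + 1            ≡⟨ trans (cong (_+ 1) (*-identityʳ a)) (+-comm a 1) ⟩
  suc a                ≈⟨ congruent (n%n≡0 (suc a)) ⟩
  0                    ∎))
  where
  open SetoidReasoning mod-setoid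
  a²≡1 : a ^ 2 ≡ 1 mod suc a
  a²≡1 = mod-trans (≡⇒≡-mod (cong (a *_) (*-identityʳ a))) (n*n≡1-mod-suc-n a)

^odd+1-composite : ∀ {a} r → 1 < a → 0 < r → Composite (a ^ suc (2 * r) + 1)
^odd+1-composite {a@(suc _)} r@(suc _) 1<a _ = composite 1+a<a^[1+2r]+1 (1+a∣a^[1+2r]+1 a r)
  where
  a<a^[1+2r] : a < a ^ suc (2 * r)
  a<a^[1+2r] = subst (_< a ^ suc (2 * r)) (*-identityʳ a) (^-monoʳ-< a 1<a {1} {suc (2 * r)} (s≤s (s≤s z≤n)))
  1+a<a^[1+2r]+1 : suc a < a ^ suc (2 * r) + 1
  1+a<a^[1+2r]+1 = subst (_< a ^ suc (2 * r) + 1) (+-comm a 1) (+-monoˡ-< 1 a<a^[1+2r])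

even⊎odd : ∀ m → ∃[ h ] (m ≡ 2 * h ⊎ m ≡ suc (2 * h))
even⊎odd zero    = 0 , inj₁ refl
even⊎odd (suc m) with even⊎odd m
... | h , inj₁ m≡2h   = h , inj₂ (cong suc m≡2h)
... | h , inj₂ m≡1+2h = suc h , inj₁ (trans (cong suc m≡1+2h) (sym (*-suc 2 h)))

fermat-exponent-pow2 : ∀ m {a} → 1 < a → 0 < m → Prime (a ^ m + 1) → ∃[ v ] m ≡ 2 ^ v
fermat-exponent-pow2 = <-rec _ step
  where
  -- The base is generalised because a ^ (2 h) + 1 = (a ^ 2) ^ h + 1.
  step : ∀ m → (∀ {h} → h < m → ∀ {a} → 1 < a → 0 < h → Prime (a ^ h + 1) → ∃[ v ] h ≡ 2 ^ v) →
         ∀ {a} → 1 < a → 0 < m → Prime (a ^ m + 1) → ∃[ v ] m ≡ 2 ^ v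
  step m rec {a} 1<a 0<m isPrime with even⊎odd m
  ... | 0         , inj₁ refl = contradiction 0<m λ ()
  ... | h@(suc _) , inj₁ refl
    with rec (subst (h <_) (*-comm h 2) (m<m*n h 2 (s≤s (s≤s z≤n)))) (^-monoˡ-< 2 1<a) z<s
             (subst Prime (cong (_+ 1) (sym (^-*-assoc a 2 h))) isPrime)
  ...   | v , h≡2^v = suc v , cong (2 *_) h≡2^v
  step _ _ _   _ _       | 0         , inj₂ refl = 0 , refl
  step _ _ 1<a _ isPrime | h@(suc _) , inj₂ refl = contradiction (^odd+1-composite h 1<a z<s) (prime⇒¬composite isPrime)

prime[3] : Prime 3
prime[3] = toWitness {a? = prime? 3} tt

mersennePrime[3] : MersennePrime 3
mersennePrime[3] = prime[3] , 2 , refl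

fermatPrime[3] : FermatPrime 3
fermatPrime[3] = prime[3] , 0 , refl

2^[1+k]≡2+[2^[1+k]∸2] : ∀ k → 2 ^ suc k ≡ 2 + (2 ^ suc k ∸ 2)
2^[1+k]≡2+[2^[1+k]∸2] k = sym (m+[n∸m]≡n (^-monoʳ-≤ 2 {1} {suc k} (s≤s z≤n)))

mersennePrime-z : ∀ k {n} → 2 ^ suc k ≡ 2 + n → MersennePrime (z n)
mersennePrime-z k {n} 2^[1+k]≡2+n
  with z-cases n (λ { refl → even≢odd (2 ^ k) 1 2^[1+k]≡2+n }) (λ { refl → even≢odd (2 ^ k) 2 2^[1+k]≡2+n })
... | inj₁ (isPrime , zn≡1+n) =
  subst Prime (sym zn≡1+n) isPrime , suc k , trans zn≡1+n (cong (_∸ 1) (sym 2^[1+k]≡2+n))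
... | inj₂ zn≡3               = subst MersennePrime (sym zn≡3) mersennePrime[3]

mersennePrime-z[2^k∸2] : ∀ k → MersennePrime (z (2 ^ k ∸ 2))
mersennePrime-z[2^k∸2] zero    = mersennePrime[3]
mersennePrime-z[2^k∸2] (suc k) = mersennePrime-z k (2^[1+k]≡2+[2^[1+k]∸2] k)

fermatPrime-z[2^m] : ∀ m → 0 < m → FermatPrime (z (2 ^ m))
fermatPrime-z[2^m] (suc m) _ with z-cases (2 ^ suc m) (even≢odd (2 ^ m) 0) (even≢odd (2 ^ m) 1)
... | inj₂ z≡3 = subst FermatPrime (sym z≡3) fermatPrime[3]
... | inj₁ (isPrime , z≡1+2^[1+m])
  with v , 1+m≡2^v ← fermat-exponent-pow2 (suc m) (s≤s (s≤s z≤n)) z<s (subst Prime (+-comm 1 (2 ^ suc m)) isPrime) =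
  subst Prime (sym z≡1+2^[1+m]) isPrime , v ,
  trans z≡1+2^[1+m] (trans (+-comm 1 (2 ^ suc m)) (cong (λ e → 2 ^ e + 1) 1+m≡2^v))

z[2^k∸2]≡2^k∸1 : ∀ k → Prime (2 ^ k ∸ 1) → z (2 ^ k ∸ 2) ≡ 2 ^ k ∸ 1
z[2^k∸2]≡2^k∸1 zero    isPrime = contradiction isPrime ¬prime[0]
z[2^k∸2]≡2^k∸1 (suc k) isPrime =
  trans (z-prime (subst Prime 2^[1+k]∸1≡1+n isPrime) n≢1) (sym 2^[1+k]∸1≡1+n)
  where
  n = 2 ^ suc k ∸ 2
  2^[1+k]∸1≡1+n : 2 ^ suc k ∸ 1 ≡ suc n
  2^[1+k]∸1≡1+n = cong (_∸ 1) (2^[1+k]≡2+[2^[1+k]∸2] k)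
  n≢1 : n ≢ 1
  n≢1 n≡1 = even≢odd (2 ^ k) 1 (trans (2^[1+k]≡2+[2^[1+k]∸2] k) (cong (2 +_) n≡1))

z[2^m]≡2^m+1 : ∀ m → 0 < m → Prime (2 ^ m + 1) → z (2 ^ m) ≡ 2 ^ m + 1
z[2^m]≡2^m+1 (suc m) _ isPrime =
  trans (z-prime (subst Prime (+-comm (2 ^ suc m) 1) isPrime) (even≢odd (2 ^ m) 0)) (+-comm 1 (2 ^ suc m))

m₁-surjective : (p : ℕ) → MersennePrime p → ∃[ n ] m₁ n ≡ p
m₁-surjective _ (isPrime , zero  , refl) = contradiction isPrime ¬prime[0]
m₁-surjective _ (isPrime , suc k , refl) =
  k , trans (cong (λ e → z (2 ^ e ∸ 2)) (+-comm k 1)) (z[2^k∸2]≡2^k∸1 (suc k) isPrime)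

m₂-surjective : (p : ℕ) → MersennePrime p → ∃[ n ] m₂ n ≡ p
m₂-surjective _ (isPrime , zero  , refl) = contradiction isPrime ¬prime[0]
m₂-surjective _ (isPrime , suc k , refl) =
  k , trans (cong (λ e → z (2 ^ e ∸ 2)) (t-prime (mersenne-exponent-prime (suc k) isPrime)))
            (z[2^k∸2]≡2^k∸1 (suc k) isPrime)

f₁-surjective : (p : ℕ) → FermatPrime p → ∃[ n ] f₁ n ≡ p
f₁-surjective _ (isPrime , zero  , refl) = 1 , refl   -- f₁ 1 = z 8 = 3, as 9 ∣ 8!
f₁-surjective _ (isPrime , suc k , refl) =
  2 ^ suc k ∸ 2 ,
  trans (cong (λ e → z (2 ^ e)) (trans (+-comm (2 ^ suc k ∸ 2) 2) (sym (2^[1+k]≡2+[2^[1+k]∸2] k))))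
        (z[2^m]≡2^m+1 (2 ^ suc k) (m^n>0 2 (suc k)) isPrime)

f₂-surjective : (p : ℕ) → FermatPrime p → ∃[ n ] f₂ n ≡ p
f₂-surjective _ (isPrime , k , refl) = k , z[2^m]≡2^m+1 (2 ^ k) (m^n>0 2 k) isPrime

mainTheorem1 : (((n : ℕ) → MersennePrime (m₁ n) × MersennePrime (m₂ n))
                 × ((p : ℕ) → MersennePrime p → ∃[ n ] m₁ n ≡ p)
                 × ((p : ℕ) → MersennePrime p → ∃[ n ] m₂ n ≡ p))
               × (((n : ℕ) → FermatPrime (f₁ n) × FermatPrime (f₂ n))
                 × ((p : ℕ) → FermatPrime p → ∃[ n ] f₁ n ≡ p)
                 × ((p : ℕ) → FermatPrime p → ∃[ n ] f₂ n ≡ p))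
mainTheorem1 =
  ( (λ n → mersennePrime-z[2^k∸2] (n + 1) , mersennePrime-z[2^k∸2] (t n))
  , m₁-surjective , m₂-surjective )
  , ( (λ n → fermatPrime-z[2^m] (n + 2) (subst (0 <_) (+-comm 2 n) z<s) , fermatPrime-z[2^m] (2 ^ n) (m^n>0 2 n))
    , f₁-surjective , f₂-surjective )
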